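{- For every graph $G$ and every 2-switch $\tau$ on $G$, $|\alpha(\tau(G))-\alpha(G)|\le 1$, where $\alpha$ denotes the independence number.
   Context: Graphs are finite and simple. A 2-switch on $G$ is specified by four distinct vertices $a,b,c,d$ with $ab,cd\in E(G)$ and $ac,bd\notin E(G)$; it produces $\tau(G)=G-ab-cd+ac+bd$. $\alpha(G)$ is the maximum size of a set of pairwise non-adjacent vertices of $G$. -}

module Defs where

open import Data.Nat using (ℕ; _≤_)
open import Data.Fin using (Fin; _≟_)
open import Data.Fin.Subset using (Subset; _∈_; ∣_∣)
open import Data.Bool using (Bool; true; false; _∧_; _∨_; not; T)
open import Data.Product using (Σ; _×_)
open import Relation.Binary.PropositionalEquality using (_≡_; _≢_)
open import Relation.Nullary.Decidable using (⌊_⌋)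

record Graph (n : ℕ) : Set where
  field
    adj   : Fin n → Fin n → Bool
    sym   : ∀ u v → adj u v ≡ adj v u
    irref : ∀ u → adj u u ≡ false
open Graph public

Edge : ∀ {n} → Graph n → Fin n → Fin n → Set
Edge G u v = adj G u v ≡ true

record Is2Switch {n : ℕ} (G : Graph n) (a b c d : Fin n) : Set where
  field
    a≢b : a ≢ b
    a≢c : a ≢ c
    a≢d : a ≢ d
    b≢c : b ≢ c
    b≢d : b ≢ d
    c≢d : c ≢ d
    ab∈E : adj G a b ≡ true
    cd∈E : adj G c d ≡ true
    ac∉E : adj G a c ≡ false
    bd∉E : adj G b d ≡ false

isPair : ∀ {n} → Fin n → Fin n → Fin n → Fin n → Bool
isPair u v x y = (⌊ x ≟ u ⌋ ∧ ⌊ y ≟ v ⌋) ∨ (⌊ x ≟ v ⌋ ∧ ⌊ y ≟ u ⌋)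

switchAdj : ∀ {n} → Graph n → (a b c d : Fin n) → Fin n → Fin n → Bool
switchAdj G a b c d x y =
  ((adj G x y ∧ not (isPair a b x y)) ∧ not (isPair c d x y))
    ∨ isPair a c x y ∨ isPair b d x y

-- τ(G); the hypothesis that (a,b,c,d) is a 2-switch is required, and it is
-- used to show the result is again a simple graph (a ≢ c, b ≢ d).
switch : ∀ {n} (G : Graph n) (a b c d : Fin n) → Is2Switch G a b c d → Graph n
switch G a b c d s = record
  { adj   = switchAdj G a b c d
  ; sym   = symProof
  ; irref = irrefProof
  }
  where
  open import Data.Bool.Properties using (∧-comm; ∨-comm)
  open import Relation.Binary.PropositionalEquality using (refl; cong; cong₂)
  open import Relation.Nullary using (yes; no)
  open import Data.Empty using (⊥-elim)

  pairSym : ∀ u v x y → isPair u v x y ≡ isPair u v y x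
  pairSym u v x y = trans' (∨-comm (⌊ x ≟ u ⌋ ∧ ⌊ y ≟ v ⌋) _)
                           (cong₂ _∨_ (∧-comm ⌊ x ≟ v ⌋ ⌊ y ≟ u ⌋)
                                      (∧-comm ⌊ x ≟ u ⌋ ⌊ y ≟ v ⌋))
    where
    open import Relation.Binary.PropositionalEquality using () renaming (trans to trans')

  symProof : ∀ x y → switchAdj G a b c d x y ≡ switchAdj G a b c d y x
  symProof x y rewrite sym G x y | pairSym a b x y | pairSym c d x y
                     | pairSym a c x y | pairSym b d x y = refl

  pairDiag : ∀ u v x → u ≢ v → isPair u v x x ≡ false
  pairDiag u v x u≢v with x ≟ u | x ≟ v
  ... | yes refl | yes refl = ⊥-elim (u≢v refl)
  ... | yes _    | no _     = refl
  ... | no _     | yes _    = refl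
  ... | no _     | no _     = refl

  irrefProof : ∀ x → switchAdj G a b c d x x ≡ false
  irrefProof x rewrite irref G x | pairDiag a c x (Is2Switch.a≢c s)
                     | pairDiag b d x (Is2Switch.b≢d s) = refl

Independent : ∀ {n} → Graph n → Subset n → Set
Independent G S = ∀ u v → u ∈ S → v ∈ S → adj G u v ≡ false

IsIndependenceNumber : ∀ {n} → Graph n → ℕ → Set
IsIndependenceNumber G k =
  Σ (Subset _) (λ S → Independent G S × ∣ S ∣ ≡ k)
  × (∀ S → Independent G S → ∣ S ∣ ≤ k)

-- An independent set of G contains at
-- most one of a, b, and after deleting a and b it meets neither new edge ac, bd,
-- so it stays independent in τ(G) and has lost at most one vertex: α(G) ≤ α(τ(G)) + 1.
-- Symmetrically, deleting a and c from an independent set of τ(G), which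
-- contains at most one of them, avoids the removed edges ab, cd: α(τ(G)) ≤ α(G) + 1.
module Submission where

open import Defs
open import Data.Nat using (ℕ; _≤_; ∣_-_∣; zero; suc; z≤n; s≤s)
open import Data.Nat.Properties using (≤-refl; ≤-trans; n≤1+n)
open import Data.Fin using (Fin; _≟_)
open import Data.Fin.Subset using (Subset; _∈_; _∉_; _⊆_; ∣_∣; inside; outside)
open import Data.Fin.Subset.Properties using (_∈?_; p⊆q⇒∣p∣≤∣q∣)
open import Data.Vec using (_∷_; here; there; _[_]≔_)
open import Data.Vec.Properties using ([]=-injective; []≔-updates; []≔-minimal)
open import Data.Bool using (true; false)
open import Data.Bool.Properties using (∨-zeroʳ; ¬-not; not-¬)
open import Data.Product using (_×_; _,_)
open import Data.Empty using (⊥-elim)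
open import Function using (_∘_)
open import Relation.Nullary using (¬_; yes; no)
open import Relation.Binary.PropositionalEquality using (_≡_; _≢_; refl)

private
  variable
    n : ℕ

∣m-n∣≤1 : ∀ {m n} → m ≤ suc n → n ≤ suc m → ∣ m - n ∣ ≤ 1
∣m-n∣≤1 {zero}        {zero}        _         _         = z≤n
∣m-n∣≤1 {zero}        {suc zero}    _         _         = s≤s z≤n
∣m-n∣≤1 {suc zero}    {zero}        _         _         = s≤s z≤n
∣m-n∣≤1 {suc m}       {suc n}       (s≤s m≤n) (s≤s n≤m) = ∣m-n∣≤1 m≤n n≤m
∣m-n∣≤1 {zero}        {suc (suc n)} _         (s≤s ())
∣m-n∣≤1 {suc (suc m)} {zero}        (s≤s ())  _

-- Stdlib's `p - x` does not reduce structurally (its `_─_` is a `zipWith` of a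
-- where-bound function capturing the whole vectors), so removal is a vector update.
infixl 5 _∖_
_∖_ : Subset n → Fin n → Subset n
p ∖ x = p [ x ]≔ outside

x∉p∖x : ∀ (p : Subset n) x → x ∉ p ∖ x
x∉p∖x p x x∈p∖x with () ← []=-injective x∈p∖x ([]≔-updates p x)

p∖x⊆p : ∀ (p : Subset n) x → p ∖ x ⊆ p
p∖x⊆p (_ ∷ p) Fin.zero    (there y∈p∖x) = there y∈p∖x
p∖x⊆p (_ ∷ p) (Fin.suc x) here          = here
p∖x⊆p (_ ∷ p) (Fin.suc x) (there y∈p∖x) = there (p∖x⊆p p x y∈p∖x)

x∉p⇒p⊆p∖x : ∀ {p : Subset n} {x} → x ∉ p → p ⊆ p ∖ x
x∉p⇒p⊆p∖x {p = p} {x} x∉p {y} y∈p = []≔-minimal p y x (λ { refl → x∉p y∈p }) y∈p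

∣p∣≤1+∣p∖x∣ : ∀ (p : Subset n) x → ∣ p ∣ ≤ suc ∣ p ∖ x ∣
∣p∣≤1+∣p∖x∣ (inside  ∷ p) Fin.zero    = ≤-refl
∣p∣≤1+∣p∖x∣ (outside ∷ p) Fin.zero    = n≤1+n _
∣p∣≤1+∣p∖x∣ (inside  ∷ p) (Fin.suc x) = s≤s (∣p∣≤1+∣p∖x∣ p x)
∣p∣≤1+∣p∖x∣ (outside ∷ p) (Fin.suc x) = ∣p∣≤1+∣p∖x∣ p x

∣p∣≤1+∣p∖x∖y∣ : ∀ (p : Subset n) x y → ¬ (x ∈ p × y ∈ p) → ∣ p ∣ ≤ suc ∣ p ∖ x ∖ y ∣
∣p∣≤1+∣p∖x∖y∣ p x y ¬both with x ∈? p
... | yes x∈p = ≤-trans (∣p∣≤1+∣p∖x∣ p x)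
  (s≤s (p⊆q⇒∣p∣≤∣q∣ (x∉p⇒p⊆p∖x (λ y∈p∖x → ¬both (x∈p , p∖x⊆p p x y∈p∖x)))))
... | no x∉p = ≤-trans (p⊆q⇒∣p∣≤∣q∣ (x∉p⇒p⊆p∖x x∉p)) (∣p∣≤1+∣p∖x∣ (p ∖ x) y)

x∈p∖y∖z⁻ : ∀ {p : Subset n} {x y z} → x ∈ p ∖ y ∖ z → x ∈ p × x ≢ y × x ≢ z
x∈p∖y∖z⁻ {p = p} {x} {y} {z} x∈p∖y∖z =
    p∖x⊆p p y x∈p∖y
  , (λ { refl → x∉p∖x p x x∈p∖y })
  , (λ { refl → x∉p∖x (p ∖ y) x x∈p∖y∖z })
  where
  x∈p∖y : x ∈ p ∖ y
  x∈p∖y = p∖x⊆p (p ∖ y) z x∈p∖y∖z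

record SubgraphAwayFrom (H G : Graph n) (u v : Fin n) : Set where
  constructor subgraphAwayFrom
  field
    edge : ∀ {x y} → x ≢ u → x ≢ v → y ≢ u → y ≢ v → Edge H x y → Edge G x y
open SubgraphAwayFrom

edge⇒¬both∈independent : ∀ {G : Graph n} {S u v} →
  Independent G S → Edge G u v → ¬ (u ∈ S × v ∈ S)
edge⇒¬both∈independent ind uv∈E (u∈S , v∈S) = not-¬ (ind _ _ u∈S v∈S) uv∈E

independent-removing : ∀ {G H : Graph n} {u v S} →
  SubgraphAwayFrom H G u v → Independent G S → Independent H (S ∖ u ∖ v)
independent-removing (subgraphAwayFrom H⊑G) ind x y x∈S′ y∈S′
  with x∈p∖y∖z⁻ x∈S′ | x∈p∖y∖z⁻ y∈S′
... | x∈S , x≢u , x≢v | y∈S , y≢u , y≢v =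
  ¬-not (not-¬ (ind x y x∈S y∈S) ∘ H⊑G x≢u x≢v y≢u y≢v)

independenceNumber-≤-suc : ∀ {G H : Graph n} {u v α β} →
  Edge G u v → SubgraphAwayFrom H G u v →
  IsIndependenceNumber G α → IsIndependenceNumber H β → α ≤ suc β
independenceNumber-≤-suc {G = G} {u = u} {v} uv∈E H⊑G ((S , indS , refl) , _) (_ , maxH) =
  ≤-trans (∣p∣≤1+∣p∖x∖y∣ S u v (edge⇒¬both∈independent {G = G} indS uv∈E))
          (s≤s (maxH _ (independent-removing H⊑G indS)))

isPair≡false : ∀ (u v x y : Fin n) → x ≢ u → y ≢ u → isPair u v x y ≡ false
isPair≡false u v x y x≢u y≢u with x ≟ u | y ≟ u
... | yes x≡u | _       = ⊥-elim (x≢u x≡u)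
... | no _    | yes y≡u = ⊥-elim (y≢u y≡u)
... | no _    | no _    with x ≟ v | y ≟ v
...   | yes _ | yes _ = refl
...   | yes _ | no _  = refl
...   | no _  | yes _ = refl
...   | no _  | no _  = refl

isPair-refl : ∀ (u v : Fin n) → isPair u v u v ≡ true
isPair-refl u v with u ≟ u | v ≟ v
... | yes _   | yes _   = refl
... | no u≢u  | _       = ⊥-elim (u≢u refl)
... | yes _   | no v≢v  = ⊥-elim (v≢v refl)

module _ (G : Graph n) {a b c d : Fin n} (s : Is2Switch G a b c d) where
  τG : Graph n
  τG = switch G a b c d s

  ac∈τE : Edge τG a c
  ac∈τE rewrite isPair-refl a c = ∨-zeroʳ _

  τG⊑G-away-from-ab : SubgraphAwayFrom τG G a b
  τG⊑G-away-from-ab .edge {x} {y} x≢a x≢b y≢a y≢b xy∈τE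
    rewrite isPair≡false a c x y x≢a y≢a | isPair≡false b d x y x≢b y≢b
    with adj G x y
  ... | true  = refl
  ... | false = xy∈τE

  G⊑τG-away-from-ac : SubgraphAwayFrom G τG a c
  G⊑τG-away-from-ac .edge {x} {y} x≢a x≢c y≢a y≢c xy∈E
    rewrite isPair≡false a b x y x≢a y≢a | isPair≡false c d x y x≢c y≢c | xy∈E = refl

mainTheorem10 : ∀ {n} (G : Graph n) (a b c d : Fin n) (s : Is2Switch G a b c d)
                  (α₀ α₁ : ℕ) → IsIndependenceNumber G α₀
                  → IsIndependenceNumber (switch G a b c d s) α₁
                  → ∣ α₁ - α₀ ∣ ≤ 1
mainTheorem10 G a b c d s α₀ α₁ αG ατG =
  ∣m-n∣≤1
    (independenceNumber-≤-suc (ac∈τE G s) (G⊑τG-away-from-ac G s) ατG αG)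
    (independenceNumber-≤-suc (Is2Switch.ab∈E s) (τG⊑G-away-from-ab G s) αG ατG)
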